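{- Let $x[1..n]$ be a framed word as described in the context. For every $i\in[2,n]$, the word $x[\mathit{prev}_{ -1}[i]..i-1]$ is an inverse Lyndon word.
   Context: Let $(\Sigma,<)$ be a totally ordered alphabet. The lexicographic order $\prec$ on words is: $u\prec v$ iff either $v=uw$ for some non-empty word $w$, or $u=ary$, $v=asy'$ for words $a,y,y'$ and letters $r<s$. A framed word is a word $x[1..n]$ ($n\ge 2$) with $x[1]=\#$, $x[n]=\$$ and $x[2..n-1]\in\Sigma^*$, where the order on $\Sigma$ is extended by $\# > \$ > a$ for all $a\in\Sigma$. For $1\le i\le n$, $x_i=x[i..n]$. A non-empty word $w$ is an inverse Lyndon word if $s\prec w$ for every non-empty proper suffix $s$ of $w$. The previous greater suffix array is $\mathit{prev}_{ -1}[i]=\max\{j\in[1,i)\mid x_j\succ x_i\}$, with the conventions $\mathit{prev}_{ -1}[1]=0$ and $\mathit{prev}_{ -1}[n]=1$. -}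

module Defs where

open import Level using (Level; 0ℓ)
open import Data.Nat using (ℕ; zero; suc; _+_; _∸_; _≤_; _<_)
open import Data.List using (List; []; _∷_; _++_; [_]; map; drop; take; length)
open import Data.Product using (Σ; _×_; ∃; ∃-syntax; _,_)
open import Data.Sum using (_⊎_)
open import Relation.Nullary using (¬_)
open import Relation.Binary using (Rel; IsStrictTotalOrder)
open import Relation.Binary.PropositionalEquality using (_≡_)

data Letter (A : Set) : Set where
  hash   : Letter A
  dollar : Letter A
  lit    : A → Letter A

data LetterLt {A : Set} (_<A_ : Rel A 0ℓ) : Rel (Letter A) 0ℓ where
  lit<lit    : ∀ {a b} → a <A b → LetterLt _<A_ (lit a) (lit b)
  lit<dollar : ∀ {a} → LetterLt _<A_ (lit a) dollar
  lit<hash   : ∀ {a} → LetterLt _<A_ (lit a) hash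
  dollar<hash : LetterLt _<A_ dollar hash

Lex : {B : Set} → Rel B 0ℓ → Rel (List B) 0ℓ
Lex {B} _<B_ u v =
  (Σ (List B) λ w → ¬ (w ≡ []) × v ≡ u ++ w)
  ⊎ (Σ (List B) λ a → Σ (List B) λ y → Σ (List B) λ y' → Σ B λ r → Σ B λ s →
       r <B s × u ≡ a ++ (r ∷ y) × v ≡ a ++ (s ∷ y'))

InverseLyndon : {B : Set} → Rel B 0ℓ → List B → Set
InverseLyndon _<B_ w =
  ¬ (w ≡ []) × (∀ k → 1 ≤ k → k < length w → Lex _<B_ (drop k w) w)

-- The framed word  # w $  (positions 1..n with n = length w + 2).
framed : {A : Set} → List A → List (Letter A)
framed w = hash ∷ (map lit w ++ [ dollar ])

-- Suffix x_i = x[i..n]  (1-based i).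
suffixAt : {B : Set} → List B → ℕ → List B
suffixAt x i = drop (i ∸ 1) x

-- Factor x[j..k]  (1-based, inclusive; empty if k < j).
factor : {B : Set} → List B → ℕ → ℕ → List B
factor x j k = take (suc k ∸ j) (drop (j ∸ 1) x)

-- p = prev_{-1}[i] for 2 ≤ i ≤ n, i.e. p = max { j ∈ [1,i) | x_j ≻ x_i }:
-- p is in [1,i), x_p ≻ x_i, and no j with p < j < i has x_j ≻ x_i.
-- (For i = n this maximum is 1, agreeing with the convention prev_{-1}[n] = 1.)
IsPrevGreater : {B : Set} → Rel B 0ℓ → List B → ℕ → ℕ → Set
IsPrevGreater _<B_ x i p =
  1 ≤ p × p < i × Lex _<B_ (suffixAt x i) (suffixAt x p)
  × (∀ j → p < j → j < i → ¬ Lex _<B_ (suffixAt x i) (suffixAt x j))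

-- Let x_j be a suffix starting strictly between p = prev₋₁[i] and i. By
-- maximality of p, x_j is not above x_i, so x_j ≼ x_i ≺ x_p by totality of the
-- lexicographic order. The suffix x[j..i-1] of x[p..i-1] is a shorter prefix of
-- x_j than x[p..i-1] is of x_p, and truncating u ≺ v to a shorter prefix of u
-- than of v keeps the strict inequality.
module Submission where

open import Defs
open import Level using (0ℓ)
open import Function using (_∘_)
open import Data.Nat using (ℕ; zero; suc; _+_; _∸_; _≤_; _<_; s≤s; z≤n)
open import Data.Nat.Properties
  using (≤-trans; ≤-reflexive; <⇒≤; m⊓n≤m; m<m+n; +-monoʳ-<; ∸-monoʳ-<; m<n⇒0<n∸m; m+[n∸m]≡n; m≤n⇒m≤1+n)
open import Data.List using (List; []; _∷_; _++_; take; drop; length)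
open import Data.List.Properties using (length-take; take-drop; drop-drop)
open import Data.List.Relation.Binary.Lex.Strict
  using (Lex-<; base; halt; this; next; <-isStrictTotalOrder)
open import Data.Product using (_,_)
open import Data.Sum using (inj₁; inj₂)
open import Data.Empty using (⊥-elim)
open import Relation.Binary
  using (Rel; IsStrictTotalOrder; Transitive; Trichotomous; tri<; tri≈; tri>)
open import Relation.Binary.Structures.Biased using (isStrictTotalOrderᶜ)
open import Relation.Binary.PropositionalEquality
  using (_≡_; _≢_; refl; sym; cong; subst; isEquivalence)

module _ {A : Set} {_<A_ : Rel A 0ℓ} where

  lit-injective : ∀ {a b : A} → lit a ≡ lit b → a ≡ b
  lit-injective refl = refl

  lit<lit⁻¹ : ∀ {a b} → LetterLt _<A_ (lit a) (lit b) → a <A b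
  lit<lit⁻¹ (lit<lit a<b) = a<b

  LetterLt-trans : Transitive _<A_ → Transitive (LetterLt _<A_)
  LetterLt-trans trans (lit<lit a<b) (lit<lit b<c) = lit<lit (trans a<b b<c)
  LetterLt-trans trans (lit<lit _)   lit<dollar    = lit<dollar
  LetterLt-trans trans (lit<lit _)   lit<hash      = lit<hash
  LetterLt-trans trans lit<dollar    dollar<hash   = lit<hash

  LetterLt-compare : Trichotomous _≡_ _<A_ → Trichotomous _≡_ (LetterLt _<A_)
  LetterLt-compare compare hash    hash    = tri≈ (λ ()) refl (λ ())
  LetterLt-compare compare hash    dollar  = tri> (λ ()) (λ ()) dollar<hash
  LetterLt-compare compare hash    (lit _) = tri> (λ ()) (λ ()) lit<hash
  LetterLt-compare compare dollar  hash    = tri< dollar<hash (λ ()) (λ ())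
  LetterLt-compare compare dollar  dollar  = tri≈ (λ ()) refl (λ ())
  LetterLt-compare compare dollar  (lit _) = tri> (λ ()) (λ ()) lit<dollar
  LetterLt-compare compare (lit _) hash    = tri< lit<hash (λ ()) (λ ())
  LetterLt-compare compare (lit _) dollar  = tri< lit<dollar (λ ()) (λ ())
  LetterLt-compare compare (lit a) (lit b) with compare a b
  ... | tri< a<b a≢b b≮a = tri< (lit<lit a<b) (a≢b ∘ lit-injective) (b≮a ∘ lit<lit⁻¹)
  ... | tri≈ a≮b a≡b b≮a = tri≈ (a≮b ∘ lit<lit⁻¹) (cong lit a≡b) (b≮a ∘ lit<lit⁻¹)
  ... | tri> a≮b a≢b b<a = tri> (a≮b ∘ lit<lit⁻¹) (a≢b ∘ lit-injective) (lit<lit b<a)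

  LetterLt-isStrictTotalOrder :
    IsStrictTotalOrder _≡_ _<A_ → IsStrictTotalOrder _≡_ (LetterLt _<A_)
  LetterLt-isStrictTotalOrder sto = isStrictTotalOrderᶜ record
    { isEquivalence = isEquivalence
    ; trans         = LetterLt-trans trans
    ; compare       = LetterLt-compare compare
    } where open IsStrictTotalOrder sto using (trans; compare)

module _ {B : Set} {_≈_ : Rel B 0ℓ} {_≺_ : Rel B 0ℓ} where

  Lex-<⇒≢[] : ∀ {u v} → Lex-< _≈_ _≺_ u v → v ≢ []
  Lex-<⇒≢[] halt       ()
  Lex-<⇒≢[] (this _)   ()
  Lex-<⇒≢[] (next _ _) ()

  Lex-<-take : ∀ {m n u v} → m < n → Lex-< _≈_ _≺_ u v →
               Lex-< _≈_ _≺_ (take m u) (take n v)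
  Lex-<-take              _         (base ())
  Lex-<-take {zero}       (s≤s _)   halt            = halt
  Lex-<-take {zero}       (s≤s _)   (this _)        = halt
  Lex-<-take {zero}       (s≤s _)   (next _ _)      = halt
  Lex-<-take {suc _}      (s≤s _)   halt            = halt
  Lex-<-take {suc _}      (s≤s _)   (this x≺y)      = this x≺y
  Lex-<-take {suc _}      (s≤s m<n) (next x≈y u<v)  = next x≈y (Lex-<-take m<n u<v)

module _ {B : Set} {_<B_ : Rel B 0ℓ} where

  Lex-<-++-nonempty : ∀ u {w} → w ≢ [] → Lex-< _≡_ _<B_ u (u ++ w)
  Lex-<-++-nonempty []      {[]}    w≢[] = ⊥-elim (w≢[] refl)
  Lex-<-++-nonempty []      {_ ∷ _} _    = halt
  Lex-<-++-nonempty (_ ∷ u) w≢[]         = next refl (Lex-<-++-nonempty u w≢[])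

  Lex-<-++-mismatch : ∀ a {r s y y'} → r <B s → Lex-< _≡_ _<B_ (a ++ r ∷ y) (a ++ s ∷ y')
  Lex-<-++-mismatch []      r<s = this r<s
  Lex-<-++-mismatch (_ ∷ a) r<s = next refl (Lex-<-++-mismatch a r<s)

  Lex⇒Lex-< : ∀ {u v} → Lex _<B_ u v → Lex-< _≡_ _<B_ u v
  Lex⇒Lex-< {u} (inj₁ (_ , w≢[] , refl))                     = Lex-<-++-nonempty u w≢[]
  Lex⇒Lex-<     (inj₂ (a , _ , _ , _ , _ , r<s , refl , refl)) = Lex-<-++-mismatch a r<s

  Lex-<⇒Lex : ∀ {u v} → Lex-< _≡_ _<B_ u v → Lex _<B_ u v
  Lex-<⇒Lex (base ())
  Lex-<⇒Lex (halt {y} {ys})                 = inj₁ (y ∷ ys , (λ ()) , refl)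
  Lex-<⇒Lex (this {x} {xs} {y} {ys} x<y)     = inj₂ ([] , xs , ys , x , y , x<y , refl , refl)
  Lex-<⇒Lex (next {x} refl u<v) with Lex-<⇒Lex u<v
  ... | inj₁ (w , w≢[] , refl)                       = inj₁ (w , w≢[] , refl)
  ... | inj₂ (a , y , y' , r , s , r<s , refl , refl) =
          inj₂ (x ∷ a , y , y' , r , s , r<s , refl , refl)

  drop-take : ∀ {k m} (u : List B) → k ≤ m → drop k (take m u) ≡ take (m ∸ k) (drop k u)
  drop-take {k} {m} u k≤m =
    subst (λ n → drop k (take n u) ≡ take (m ∸ k) (drop k u))
          (m+[n∸m]≡n k≤m) (sym (take-drop (m ∸ k) k u))

  take-inverseLyndon : ∀ m u → 1 ≤ m → u ≢ [] →
    (∀ k → 1 ≤ k → k < m → Lex-< _≡_ _<B_ (drop k u) u) →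
    InverseLyndon _<B_ (take m u)
  take-inverseLyndon m       []      _       u≢[] _       = ⊥-elim (u≢[] refl)
  take-inverseLyndon (suc m) (x ∷ u) (s≤s _) _    suffix< = (λ ()) , truncated
    where
    truncated : ∀ k → 1 ≤ k → k < length (take (suc m) (x ∷ u)) →
                Lex _<B_ (drop k (take (suc m) (x ∷ u))) (take (suc m) (x ∷ u))
    truncated k 1≤k k<len =
      subst (λ v → Lex _<B_ v (take (suc m) (x ∷ u))) (sym (drop-take (x ∷ u) (<⇒≤ k<m)))
        (Lex-<⇒Lex (Lex-<-take (∸-monoʳ-< 1≤k (<⇒≤ k<m)) (suffix< k 1≤k k<m)))
      where
      k<m : k < suc m
      k<m = ≤-trans k<len (s≤s (≤-trans (≤-reflexive (length-take m u)) (m⊓n≤m m (length u))))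

module _ {B : Set} {_<B_ : Rel B 0ℓ} (sto : IsStrictTotalOrder _≡_ _<B_) where

  open IsStrictTotalOrder (<-isStrictTotalOrder sto) using (compare; trans; <-respˡ-≈; module Eq)

  prevGreater⇒suffix< : ∀ {x i p j} → IsPrevGreater _<B_ x i p → p < j → j < i →
                        Lex-< _≡_ _<B_ (suffixAt x j) (suffixAt x p)
  prevGreater⇒suffix< {x} {i} {j = j} (_ , _ , xi≺xp , maximal) p<j j<i
    with compare (suffixAt x j) (suffixAt x i)
  ... | tri< xj≺xi _ _ = trans xj≺xi (Lex⇒Lex-< xi≺xp)
  ... | tri≈ _ xj≋xi _ = <-respˡ-≈ (Eq.sym xj≋xi) (Lex⇒Lex-< xi≺xp)
  ... | tri> _ _ xi≺xj = ⊥-elim (maximal j p<j j<i (Lex-<⇒Lex xi≺xj))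

  prevGreater-factor-inverseLyndon : ∀ x {i p} → IsPrevGreater _<B_ x i p →
                                     InverseLyndon _<B_ (factor x p (i ∸ 1))
  prevGreater-factor-inverseLyndon x {suc (suc i)} {suc p}
    prev@(s≤s z≤n , s≤s (s≤s p≤i) , xi≺xp , _) =
    take-inverseLyndon (suc i ∸ p) (drop p x) (m<n⇒0<n∸m (s≤s p≤i))
      (Lex-<⇒≢[] (Lex⇒Lex-< xi≺xp)) suffix<
    where
    suffix< : ∀ k → 1 ≤ k → k < suc i ∸ p → Lex-< _≡_ _<B_ (drop k (drop p x)) (drop p x)
    suffix< k 1≤k k<i-p =
      subst (λ v → Lex-< _≡_ _<B_ v (drop p x)) (sym (drop-drop p k x))
        (prevGreater⇒suffix< prev p<p+k p+k<i)
      where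
      p<p+k : suc p < suc p + k
      p<p+k = s≤s (m<m+n p 1≤k)

      p+k<i : suc p + k < suc (suc i)
      p+k<i = s≤s (subst (p + k <_) (m+[n∸m]≡n (m≤n⇒m≤1+n p≤i)) (+-monoʳ-< p k<i-p))

lemma9 : (A : Set) (_<A_ : Rel A 0ℓ) → IsStrictTotalOrder _≡_ _<A_ →
    (w : List A) → (i p : ℕ) → 2 ≤ i → i ≤ length (framed w) →
    IsPrevGreater (LetterLt _<A_) (framed w) i p →
    InverseLyndon (LetterLt _<A_) (factor (framed w) p (i ∸ 1))
lemma9 A _<A_ sto w i p _ _ prev =
  prevGreater-factor-inverseLyndon (LetterLt-isStrictTotalOrder sto) (framed w) prev
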